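{- Let $\Gamma$ be a finite simple regular graph of order $n$ and let $\ell\colon V(\Gamma)\to\mathcal{I}_n$ be a distance magic labeling of $\Gamma$. For $v\in V(\Gamma)$ let $v^\ell$ be the unique vertex with $\ell(v)+\ell(v^\ell)=0$, and let $\mathcal{P}_\ell=\{\{v,v^\ell\}\colon v\in V(\Gamma)\}$. Then the following three statements are equivalent: (i) $\ell$ is self-reverse; (ii) the permutation of $V(\Gamma)$ interchanging each $v\in V(\Gamma)$ with $v^\ell$ is an automorphism of $\Gamma$; (iii) for each pair of distinct sets $A,B\in\mathcal{P}_\ell$, the bipartite subgraph of $\Gamma$ with vertex set $A\cup B$ consisting of all edges of $\Gamma$ with one endvertex in $A$ and the other in $B$ either has no edges, or is a complete bipartite graph, or consists of a pair of disjoint edges.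
   Context: For a positive integer $n$, $\mathcal{I}_n=\{1-n,3-n,\ldots,n-1\}$ is the arithmetic progression from $1-n$ to $n-1$ with common difference $2$. For a regular graph $\Gamma$ of order $n$, a distance magic labeling is a bijection $\ell\colon V(\Gamma)\to\mathcal{I}_n$ such that for every vertex the sum of the labels of its neighbors equals $0$. The labeling $\ell$ is called self-reverse if for every pair of vertices $u,v$, $u$ and $v$ are adjacent if and only if $u^\ell$ and $v^\ell$ are adjacent, where $v^\ell$ denotes the unique vertex with $\ell(v)+\ell(v^\ell)=0$. -}

module Defs where

open import Data.Nat using (ℕ; zero; suc; _<_)
open import Data.Integer as ℤ using (ℤ; +_; _-_)
open import Data.Fin using (Fin; zero; suc)
open import Data.Bool using (Bool; true; false; if_then_else_)
open import Data.Product using (Σ; ∃; ∃-syntax; _×_; _,_)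
open import Data.Sum using (_⊎_)
open import Relation.Binary.PropositionalEquality using (_≡_; _≢_)
open import Relation.Nullary using (¬_)
open import Function.Bundles using (_⇔_)
open import Function.Definitions using (Injective; Bijective)

record Graph (n : ℕ) : Set where
  field
    adj     : Fin n → Fin n → Bool
    adj-sym : ∀ u v → adj u v ≡ adj v u
    irrefl  : ∀ v → adj v v ≡ false

open Graph public

Adj : ∀ {n} → Graph n → Fin n → Fin n → Set
Adj Γ u v = adj Γ u v ≡ true

sumℤ : ∀ {n} → (Fin n → ℤ) → ℤ
sumℤ {zero}  f = + 0
sumℤ {suc n} f = f zero ℤ.+ sumℤ (λ i → f (suc i))

sumℕ : ∀ {n} → (Fin n → ℕ) → ℕ
sumℕ {zero}  f = 0
sumℕ {suc n} f = f zero Data.Nat.+ sumℕ (λ i → f (suc i))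
  where import Data.Nat

degree : ∀ {n} → Graph n → Fin n → ℕ
degree Γ v = sumℕ (λ u → if adj Γ v u then 1 else 0)

Regular : ∀ {n} → Graph n → Set
Regular Γ = ∃[ k ] (∀ v → degree Γ v ≡ k)

InI : ℕ → ℤ → Set
InI n x = ∃[ i ] (i < n × x ≡ + (1 Data.Nat.+ 2 Data.Nat.* i) - + n)
  where import Data.Nat

IsBijectionOntoI : ∀ n → (Fin n → ℤ) → Set
IsBijectionOntoI n ℓ =
  (∀ v → InI n (ℓ v)) × Injective _≡_ _≡_ ℓ × (∀ x → InI n x → ∃[ v ] ℓ v ≡ x)

neighbourSum : ∀ {n} → Graph n → (Fin n → ℤ) → Fin n → ℤ
neighbourSum Γ ℓ v = sumℤ (λ u → if adj Γ v u then ℓ u else + 0)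

IsDistanceMagic : ∀ {n} → Graph n → (Fin n → ℤ) → Set
IsDistanceMagic {n} Γ ℓ = IsBijectionOntoI n ℓ × (∀ v → neighbourSum Γ ℓ v ≡ + 0)

-- rev is the map v ↦ v^ℓ (the unique vertex with ℓ v + ℓ v^ℓ = 0)
IsReverseMap : ∀ {n} → (Fin n → ℤ) → (Fin n → Fin n) → Set
IsReverseMap ℓ rev = ∀ v → ℓ v ℤ.+ ℓ (rev v) ≡ + 0

SelfReverse : ∀ {n} → Graph n → (Fin n → Fin n) → Set
SelfReverse Γ rev = ∀ u v → Adj Γ u v ⇔ Adj Γ (rev u) (rev v)

IsAutomorphism : ∀ {n} → Graph n → (Fin n → Fin n) → Set
IsAutomorphism Γ σ = Bijective _≡_ _≡_ σ × (∀ u v → Adj Γ u v ⇔ Adj Γ (σ u) (σ v))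

InPair : ∀ {n} → (Fin n → Fin n) → Fin n → Fin n → Set
InPair rev a x = x ≡ a ⊎ x ≡ rev a

DistinctPairs : ∀ {n} → (Fin n → Fin n) → Fin n → Fin n → Set
DistinctPairs rev a b = ¬ (∀ x → (InPair rev a x → InPair rev b x) × (InPair rev b x → InPair rev a x))

NoEdges CompleteBip TwoDisjointEdges : ∀ {n} → Graph n → (Fin n → Fin n) → Fin n → Fin n → Set
NoEdges Γ rev a b = ∀ x y → InPair rev a x → InPair rev b y → ¬ Adj Γ x y
CompleteBip Γ rev a b = ∀ x y → InPair rev a x → InPair rev b y → Adj Γ x y
TwoDisjointEdges Γ rev a b =
  ∃[ x₁ ] ∃[ y₁ ] ∃[ x₂ ] ∃[ y₂ ]
    (InPair rev a x₁ × InPair rev b y₁ × InPair rev a x₂ × InPair rev b y₂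
    × x₁ ≢ x₂ × y₁ ≢ y₂ × Adj Γ x₁ y₁ × Adj Γ x₂ y₂
    × (∀ x y → InPair rev a x → InPair rev b y → Adj Γ x y →
         (x ≡ x₁ × y ≡ y₁) ⊎ (x ≡ x₂ × y ≡ y₂)))

PairCondition : ∀ {n} → Graph n → (Fin n → Fin n) → Set
PairCondition Γ rev = ∀ a b → DistinctPairs rev a b →
  NoEdges Γ rev a b ⊎ CompleteBip Γ rev a b ⊎ TwoDisjointEdges Γ rev a b

{-# OPTIONS --safe #-}
module Submission where

open import Defs
open import Data.Nat using (ℕ)
open import Data.Integer using (ℤ)
open import Data.Fin using (Fin)
open import Data.Product using (_×_)
open import Function.Bundles using (_⇔_)

open import Algebra.Definitions using (Involutive)
import Algebra.Properties.AbelianGroup as AbelianGroupProperties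
open import Data.Bool using (true; false)
open import Data.Bool.Properties using (⇔→≡)
open import Data.Empty using (⊥-elim)
open import Data.Fin using (_≟_)
open import Data.Integer using (-_)
open import Data.Integer.Properties using (+-0-abelianGroup)
open import Data.Product using (_,_; proj₂; ∃₂)
open import Data.Sum using (_⊎_; inj₁; inj₂; [_,_]′; fromInj₁; fromInj₂)
open import Function using (_∘_; const)
open import Function.Bundles using (mk⇔; mk↔ₛ′; Bijection)
open import Function.Definitions using (Injective; Bijective)
open import Function.Properties.Inverse using (↔⇒⤖)
open import Relation.Binary.PropositionalEquality
open import Relation.Nullary using (yes; no; ¬_; contradiction)

-- Injectivity of ℓ together with ℓ(v^ℓ) = -ℓ(v) makes v ↦ v^ℓ an involution,
-- hence a bijection, so (i) and (ii) say the same thing.  Writing x' = x^ℓ, an involution is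
-- an automorphism iff a'b' ~ ab and a'b ~ ab' for all a, b.  Between the pairs
-- {a, a'} and {b, b'} this means the edges are decided by the two bits ab and
-- ab': none, all, the matching {ab, a'b'}, or the matching {ab', a'b}.

reverseMap-involutive : ∀ {n} {ℓ : Fin n → ℤ} {rev : Fin n → Fin n} →
  Injective _≡_ _≡_ ℓ → IsReverseMap ℓ rev → Involutive _≡_ rev
reverseMap-involutive {ℓ = ℓ} {rev} ℓ-injective ℓ-rev v = ℓ-injective (begin
  ℓ (rev (rev v))  ≡⟨ inverseʳ-unique (ℓ (rev v)) (ℓ (rev (rev v))) (ℓ-rev (rev v)) ⟩
  - ℓ (rev v)      ≡⟨ inverseˡ-unique (ℓ v) (ℓ (rev v)) (ℓ-rev v) ⟨
  ℓ v              ∎)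
  where
  open ≡-Reasoning
  open AbelianGroupProperties +-0-abelianGroup using (inverseˡ-unique; inverseʳ-unique)

involutive⇒bijective : ∀ {A : Set} {f : A → A} → Involutive _≡_ f → Bijective _≡_ _≡_ f
involutive⇒bijective {f = f} f-involutive =
  Bijection.bijective (↔⇒⤖ (mk↔ₛ′ f f f-involutive f-involutive))

module _ {n : ℕ} (Γ : Graph n) {rev : Fin n → Fin n} (rev-involutive : Involutive _≡_ rev) where

  adj≡⇒Adj⇔ : ∀ {u v u′ v′} → adj Γ u v ≡ adj Γ u′ v′ → Adj Γ u v ⇔ Adj Γ u′ v′
  adj≡⇒Adj⇔ e = mk⇔ (trans (sym e)) (trans e)

  false⇒¬Adj : ∀ {u v} → adj Γ u v ≡ false → ¬ Adj Γ u v
  false⇒¬Adj f h = contradiction (trans (sym f) h) λ ()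

  inPair-swap : ∀ {b y} → InPair rev b y → InPair rev (rev b) y
  inPair-swap {b} (inj₁ y≡b)   = inj₂ (trans y≡b (sym (rev-involutive b)))
  inPair-swap     (inj₂ y≡b′)  = inj₁ y≡b′

  inPair-resolveʳ : ∀ {a x} → InPair rev a x → x ≢ a → x ≡ rev a
  inPair-resolveʳ p x≢a = fromInj₂ (λ x≡a → contradiction x≡a x≢a) p

  inPair-resolveˡ : ∀ {a x} → InPair rev a x → x ≢ rev a → x ≡ a
  inPair-resolveˡ p x≢a′ = fromInj₁ (λ x≡a′ → contradiction x≡a′ x≢a′) p

  distinctPairs : ∀ {u v} → v ≢ u → v ≢ rev u → DistinctPairs rev u v
  distinctPairs v≢u v≢u′ same = [ v≢u , v≢u′ ]′ (proj₂ (same _) (inj₁ refl))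

  twoDisjointEdges-swapʳ : ∀ {a b} → TwoDisjointEdges Γ rev a (rev b) → TwoDisjointEdges Γ rev a b
  twoDisjointEdges-swapʳ (x₁ , y₁ , x₂ , y₂ , px₁ , py₁ , px₂ , py₂ , x₁≢x₂ , y₁≢y₂ , e₁ , e₂ , only) =
    x₁ , y₁ , x₂ , y₂ , px₁ , unswap py₁ , px₂ , unswap py₂ , x₁≢x₂ , y₁≢y₂ , e₁ , e₂ ,
    λ x y px py → only x y px (inPair-swap py)
    where
    unswap : ∀ {b y} → InPair rev (rev b) y → InPair rev b y
    unswap (inj₁ y≡b′)  = inj₂ y≡b′
    unswap {b} (inj₂ y≡b″) = inj₁ (trans y≡b″ (rev-involutive b))

  twoDisjointEdges-partner : ∀ {a b x y} → TwoDisjointEdges Γ rev a b →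
    InPair rev a x → InPair rev b y → Adj Γ x y →
    ∃₂ λ x′ y′ → InPair rev a x′ × InPair rev b y′ × x′ ≢ x × y′ ≢ y × Adj Γ x′ y′
  twoDisjointEdges-partner (x₁ , y₁ , x₂ , y₂ , px₁ , py₁ , px₂ , py₂ , x₁≢x₂ , y₁≢y₂ , e₁ , e₂ , only) px py h
    with only _ _ px py h
  ... | inj₁ (refl , refl) = x₂ , y₂ , px₂ , py₂ , x₁≢x₂ ∘ sym , y₁≢y₂ ∘ sym , e₂
  ... | inj₂ (refl , refl) = x₁ , y₁ , px₁ , py₁ , x₁≢x₂ , y₁≢y₂ , e₁

  module _ (self-reverse : SelfReverse Γ rev) where

    adj-rev : ∀ u v → adj Γ (rev u) (rev v) ≡ adj Γ u v
    adj-rev u v = sym (⇔→≡ (self-reverse u v))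

    adj-revˡ : ∀ u v → adj Γ (rev u) v ≡ adj Γ u (rev v)
    adj-revˡ u v = begin
      adj Γ (rev u) v               ≡⟨ cong (adj Γ (rev u)) (rev-involutive v) ⟨
      adj Γ (rev u) (rev (rev v))   ≡⟨ adj-rev u (rev v) ⟩
      adj Γ u (rev v)               ∎
      where open ≡-Reasoning

    adj-uniform : ∀ {a b x y c} → adj Γ a b ≡ c → adj Γ a (rev b) ≡ c →
      InPair rev a x → InPair rev b y → adj Γ x y ≡ c
    adj-uniform p q (inj₁ refl) (inj₁ refl) = p
    adj-uniform p q (inj₁ refl) (inj₂ refl) = q
    adj-uniform p q (inj₂ refl) (inj₁ refl) = trans (adj-revˡ _ _) q
    adj-uniform p q (inj₂ refl) (inj₂ refl) = trans (adj-rev _ _) p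

    twoDisjointEdges : ∀ {a b} → Adj Γ a b → adj Γ a (rev b) ≡ false → TwoDisjointEdges Γ rev a b
    twoDisjointEdges {a} {b} p q =
      a , b , rev a , rev b , inj₁ refl , inj₁ refl , inj₂ refl , inj₂ refl ,
      a≢a′ , b≢b′ , p , trans (adj-rev a b) p , only
      where
      a≢a′ : a ≢ rev a
      a≢a′ a≡a′ =
        false⇒¬Adj q (trans (cong (λ z → adj Γ z (rev b)) a≡a′) (trans (adj-rev a b) p))
      b≢b′ : b ≢ rev b
      b≢b′ b≡b′ = false⇒¬Adj q (trans (cong (adj Γ a) (sym b≡b′)) p)
      only : ∀ x y → InPair rev a x → InPair rev b y → Adj Γ x y →
             (x ≡ a × y ≡ b) ⊎ (x ≡ rev a × y ≡ rev b)
      only _ _ (inj₁ refl) (inj₁ refl) _ = inj₁ (refl , refl)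
      only _ _ (inj₁ refl) (inj₂ refl) h = ⊥-elim (false⇒¬Adj q h)
      only _ _ (inj₂ refl) (inj₁ refl) h = ⊥-elim (false⇒¬Adj (trans (adj-revˡ a b) q) h)
      only _ _ (inj₂ refl) (inj₂ refl) _ = inj₂ (refl , refl)

    selfReverse⇒pairCondition : PairCondition Γ rev
    selfReverse⇒pairCondition a b _ with adj Γ a b in p | adj Γ a (rev b) in q
    ... | false | false = inj₁ λ _ _ px py → false⇒¬Adj (adj-uniform p q px py)
    ... | true  | true  = inj₂ (inj₁ λ _ _ → adj-uniform p q)
    ... | true  | false = inj₂ (inj₂ (twoDisjointEdges p q))
    ... | false | true  = inj₂ (inj₂ (twoDisjointEdges-swapʳ
                            (twoDisjointEdges q (trans (cong (adj Γ a) (rev-involutive b)) p))))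

  pairCases⇒selfReverseAt : ∀ {u v} →
    NoEdges Γ rev u v ⊎ CompleteBip Γ rev u v ⊎ TwoDisjointEdges Γ rev u v →
    Adj Γ u v ⇔ Adj Γ (rev u) (rev v)
  pairCases⇒selfReverseAt (inj₁ none) =
    mk⇔ (⊥-elim ∘ none _ _ (inj₁ refl) (inj₁ refl)) (⊥-elim ∘ none _ _ (inj₂ refl) (inj₂ refl))
  pairCases⇒selfReverseAt (inj₂ (inj₁ complete)) =
    mk⇔ (const (complete _ _ (inj₂ refl) (inj₂ refl))) (const (complete _ _ (inj₁ refl) (inj₁ refl)))
  pairCases⇒selfReverseAt {u} {v} (inj₂ (inj₂ matching)) = mk⇔ forward backward
    where
    forward : Adj Γ u v → Adj Γ (rev u) (rev v)
    forward h with twoDisjointEdges-partner matching (inj₁ refl) (inj₁ refl) h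
    ... | _ , _ , px , py , x≢u , y≢v , e =
      subst₂ (Adj Γ) (inPair-resolveʳ px x≢u) (inPair-resolveʳ py y≢v) e
    backward : Adj Γ (rev u) (rev v) → Adj Γ u v
    backward h with twoDisjointEdges-partner matching (inj₂ refl) (inj₂ refl) h
    ... | _ , _ , px , py , x≢u′ , y≢v′ , e =
      subst₂ (Adj Γ) (inPair-resolveˡ px x≢u′) (inPair-resolveˡ py y≢v′) e

  pairCondition⇒selfReverse : PairCondition Γ rev → SelfReverse Γ rev
  pairCondition⇒selfReverse pc u v with v ≟ u | v ≟ rev u
  ... | yes refl | _        = adj≡⇒Adj⇔ (trans (irrefl Γ u) (sym (irrefl Γ (rev u))))
  ... | no _     | yes refl =
    adj≡⇒Adj⇔ (trans (adj-sym Γ u (rev u)) (cong (adj Γ (rev u)) (sym (rev-involutive u))))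
  ... | no v≢u   | no v≢u′  = pairCases⇒selfReverseAt (pc u v (distinctPairs v≢u v≢u′))

lemma3p1 : (n : ℕ) (Γ : Graph n) → Regular Γ →
    (ℓ : Fin n → ℤ) → IsDistanceMagic Γ ℓ →
    (rev : Fin n → Fin n) → IsReverseMap ℓ rev →
    (SelfReverse Γ rev ⇔ IsAutomorphism Γ rev)
      × (IsAutomorphism Γ rev ⇔ PairCondition Γ rev)
lemma3p1 n Γ _ ℓ ((_ , ℓ-injective , _) , _) rev ℓ-rev =
    mk⇔ automorphism proj₂
  , mk⇔ (selfReverse⇒pairCondition Γ rev-involutive ∘ proj₂)
        (automorphism ∘ pairCondition⇒selfReverse Γ rev-involutive)
  where
  rev-involutive : Involutive _≡_ rev
  rev-involutive = reverseMap-involutive ℓ-injective ℓ-rev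
  automorphism : SelfReverse Γ rev → IsAutomorphism Γ rev
  automorphism = involutive⇒bijective rev-involutive ,_
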